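{- Let $G$ be a graph of order $n\ge 2$ that has a subgraph isomorphic to the path $P_n$ on $n$ vertices. Then $$\gamma_t(M(G)) = \left\lceil \frac{2n}{3}\right\rceil.$$
   Context: All graphs are finite and simple. For a graph $H$ with no isolated vertices, a total dominating set of $H$ is a set $S\subseteq V(H)$ such that every vertex of $H$ has at least one neighbor in $S$; $\gamma_t(H)$ is the minimum cardinality of a total dominating set of $H$. The middle graph $M(G)$ of a graph $G$ has vertex set $V(G)\cup E(G)$ (disjoint union), and two of its vertices $x,y$ are adjacent exactly when either $x,y\in E(G)$ are edges of $G$ sharing a common endpoint, or $x\in V(G)$, $y\in E(G)$ and $x$ is an endpoint of $y$ (no two elements of $V(G)$ are adjacent in $M(G)$). -}

module Defs where

open import Data.Nat using (ℕ; suc; _+_; _*_; _≤_; _/_)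
open import Data.Fin using (Fin; toℕ) renaming (_<_ to _<ᶠ_)
open import Data.Fin.Permutation using (Permutation′; _⟨$⟩ʳ_)
open import Data.Bool using (Bool; true; false)
open import Data.Product using (Σ; _×_; _,_; proj₁; proj₂; ∃)
open import Data.Sum using (_⊎_; inj₁; inj₂)
open import Data.List using (List; length)
open import Data.List.Membership.Propositional using (_∈_)
open import Data.List.Relation.Unary.Unique.Propositional using (Unique)
open import Relation.Binary.PropositionalEquality using (_≡_; _≢_)
open import Relation.Nullary using (¬_)
open import Data.Empty using (⊥)

record Graph (n : ℕ) : Set where
  field
    adj    : Fin n → Fin n → Bool
    sym    : ∀ i j → adj i j ≡ adj j i
    irrefl : ∀ i → adj i i ≡ false
open Graph public

-- An edge of G: an unordered pair {i , j}, stored as (i , j) with i < j.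
Edge : ∀ {n} → Graph n → Set
Edge {n} G = Σ (Fin n × Fin n) λ p → (proj₁ p <ᶠ proj₂ p) × (adj G (proj₁ p) (proj₂ p) ≡ true)

IsEndOf : ∀ {n} (G : Graph n) → Fin n → Edge G → Set
IsEndOf G v ((i , j) , _) = (v ≡ i) ⊎ (v ≡ j)

MVertex : ∀ {n} → Graph n → Set
MVertex {n} G = Fin n ⊎ Edge G

MAdj : ∀ {n} (G : Graph n) → MVertex G → MVertex G → Set
MAdj G (inj₁ u) (inj₁ v) = ⊥
MAdj G (inj₁ u) (inj₂ e) = IsEndOf G u e
MAdj G (inj₂ e) (inj₁ v) = IsEndOf G v e
MAdj G (inj₂ e) (inj₂ f) =
  (proj₁ e ≢ proj₁ f) × ∃ λ v → IsEndOf G v e × IsEndOf G v f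

-- A total dominating set of M(G), given as a duplicate-free list of its
-- elements (so its cardinality is the length of the list).
IsTDS : ∀ {n} (G : Graph n) → List (MVertex G) → Set
IsTDS G S = Unique S × (∀ x → ∃ λ y → (y ∈ S) × MAdj G x y)

γt-M≡ : ∀ {n} (G : Graph n) → ℕ → Set
γt-M≡ G k =
  (∃ λ S → IsTDS G S × length S ≡ k) × (∀ S → IsTDS G S → k ≤ length S)

-- G has a subgraph isomorphic to P_n (n = order of G): an ordering
-- π(0), …, π(n-1) of all vertices with π(i) adjacent to π(i+1).
HasSpanningPath : ∀ {n} → Graph n → Set
HasSpanningPath {n} G = Σ (Permutation′ n) λ π →
  ∀ (i j : Fin n) → toℕ j ≡ suc (toℕ i) → adj G (π ⟨$⟩ʳ i) (π ⟨$⟩ʳ j) ≡ true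

ceil2n/3 : ℕ → ℕ
ceil2n/3 n = (2 * n + 2) / 3

-- The lower bound 2n ≤ 3|S| holds in every graph: a total dominating set S of M(G)
-- contains an edge at each vertex, and a token count fits two tokens per vertex into
-- three slots per element of S.  For the upper bound, walk along the spanning path
-- v₀ v₁ … and take the edges v₀v₁ and v₁v₂, skip v₂v₃, take the next two, and so on
-- (for n = 2, the edge and one of its ends): every vertex lies on a chosen edge, every
-- chosen edge meets another chosen one, and every other edge of G shares an end with a
-- chosen edge.
module Submission where

open import Defs hiding (sym)
open import Data.Nat using (ℕ; suc; _+_; _*_; _≤_; s≤s; s≤s⁻¹; _/_)
open import Data.Nat.Properties using (1+n≢n; m+1+n≢n; +-comm; *-comm; +-monoʳ-≤; module ≤-Reasoning)
open import Data.Nat.DivMod using (/-congˡ; +-distrib-/-∣ˡ; m<n*o⇒m/o<n)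
open import Data.Nat.Divisibility using (divides)
open import Data.Nat.Tactic.RingSolver using (solve-∀)
open import Data.Fin using (Fin; suc; toℕ; inject₁; _↑ʳ_; combine; remQuot)
open import Data.Fin.Patterns using (0F; 1F; 2F; 3F; 4F)
open import Data.Fin.Properties
  using (_≟_; <-cmp; toℕ-inject₁; inject₁-injective; injective⇒≤; combine-injective; combine-remQuot)
open import Data.Fin.Permutation using (Permutation′; _⟨$⟩ʳ_; _⟨$⟩ˡ_; inverseˡ; inverseʳ)
open import Data.Bool using (true; if_then_else_)
open import Data.Product using (Σ; _×_; _,_; proj₁; proj₂; ∃; uncurry)
open import Data.Product.Properties using (≡-dec)
open import Data.Sum using (_⊎_; inj₁; inj₂)
import Data.Sum as Sum
open import Data.Sum.Properties using (inj₂-injective)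
open import Data.List using (List; []; _∷_; length; map)
open import Data.List.Properties using (length-map)
open import Data.List.Membership.Propositional using (_∈_)
open import Data.List.Membership.Propositional.Properties using (∈-map⁺; ∈-map⁻)
open import Data.List.Membership.Setoid.Properties using (index-injective)
open import Data.List.Relation.Unary.Any using (here; there; index)
import Data.List.Relation.Unary.All as All
open import Data.List.Relation.Unary.Unique.Propositional using (Unique; []; _∷_)
import Data.List.Relation.Unary.Unique.Propositional.Properties as Unique
open import Relation.Binary using (tri<; tri≈; tri>)
open import Relation.Binary.PropositionalEquality
open import Function using (_∘_)
open import Relation.Nullary using (Dec; yes; no; does; contradiction)

ceil2n/3-+3 : ∀ n → ceil2n/3 (3 + n) ≡ 2 + ceil2n/3 n
ceil2n/3-+3 n = begin
  (2 * (3 + n) + 2) / 3 ≡⟨ /-congˡ {o = 3} (shift n) ⟩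
  (6 + (2 * n + 2)) / 3 ≡⟨ +-distrib-/-∣ˡ {6} (2 * n + 2) {3} (divides 2 refl) ⟩
  2 + (2 * n + 2) / 3   ∎
  where
  open ≡-Reasoning
  shift : ∀ n → 2 * (3 + n) + 2 ≡ 6 + (2 * n + 2)
  shift = solve-∀

ceil2n/3-least : ∀ {n s} → n * 2 ≤ s * 3 → ceil2n/3 n ≤ s
ceil2n/3-least {n} {s} 2n≤3s = s≤s⁻¹ (m<n*o⇒m/o<n (begin-strict
  2 * n + 2 ≡⟨ +-comm (2 * n) 2 ⟩
  2 + 2 * n ≡⟨ cong (2 +_) (*-comm 2 n) ⟩
  2 + n * 2 <⟨ +-monoʳ-≤ 3 2n≤3s ⟩
  3 + s * 3 ∎))
  where open ≤-Reasoning

_≟ᵖ_ : ∀ {n} (p q : Fin n × Fin n) → Dec (p ≡ q)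
_≟ᵖ_ = ≡-dec _≟_ _≟_

-- Each vertex v hands two tokens to its chosen edge e(v) ∈ S.  On e(v) = ab the first
-- tokens of a and b go to slots 0 and 1, the second token of a to slot 2, and that of b
-- to slot 0 unless e(a) = ab took it.  In that case it passes on to a dominator y ∈ S of
-- ab: slot 0 if y is a vertex, else the slot of the common end c on y, which is free
-- since e(c) = ab ≠ y.  So decoding a slot recovers the token.
module TokenCounting {n} (G : Graph n) (S : List (MVertex G))
       (dominated : ∀ x → ∃ λ y → y ∈ S × MAdj G x y) where

  record EdgeOfSAt (v : Fin n) : Set where
    constructor edgeOfSAt
    field
      edge     : Edge G
      edge∈S   : inj₂ edge ∈ S
      endpoint : IsEndOf G v edge

  edgeOfSAt-every : ∀ v → EdgeOfSAt v
  edgeOfSAt-every v with dominated (inj₁ v)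
  ... | inj₁ _ , _ , ()
  ... | inj₂ e , e∈S , v∈e = edgeOfSAt e e∈S v∈e

  choice : Fin n → Fin n × Fin n
  choice v = proj₁ (EdgeOfSAt.edge (edgeOfSAt-every v))

  Slot : Set
  Slot = Σ (MVertex G) (_∈ S) × Fin 3

  overflow : (e : Edge G) → ∃ (λ y → y ∈ S × MAdj G (inj₂ e) y) → Slot
  overflow e (inj₁ w , w∈S , _)                     = (inj₁ w , w∈S) , 0F
  overflow e (inj₂ f , f∈S , _ , _ , _ , inj₁ _) = (inj₂ f , f∈S) , 2F
  overflow e (inj₂ f , f∈S , _ , _ , _ , inj₂ _) = (inj₂ f , f∈S) , 1F

  slot : (v : Fin n) → Fin 2 → EdgeOfSAt v → Slot
  slot v 0F (edgeOfSAt e e∈S (inj₁ _)) = (inj₂ e , e∈S) , 0F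
  slot v 0F (edgeOfSAt e e∈S (inj₂ _)) = (inj₂ e , e∈S) , 1F
  slot v 1F (edgeOfSAt e e∈S (inj₁ _)) = (inj₂ e , e∈S) , 2F
  slot v 1F (edgeOfSAt e e∈S (inj₂ _)) with choice (proj₁ (proj₁ e)) ≟ᵖ proj₁ e
  ... | yes _ = overflow e (dominated (inj₂ e))
  ... | no _  = (inj₂ e , e∈S) , 0F

  decode : MVertex G → Fin 3 → Fin n × Fin 2
  decode (inj₁ w) _ = proj₂ (choice w) , 1F
  decode (inj₂ ((a , b) , _)) 0F =
    if does (choice a ≟ᵖ (a , b)) then (a , 0F) else (b , 1F)
  decode (inj₂ ((a , b) , _)) 1F =
    if does (choice b ≟ᵖ (a , b)) then (b , 0F) else (proj₂ (choice b) , 1F)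
  decode (inj₂ ((a , b) , _)) 2F =
    if does (choice a ≟ᵖ (a , b)) then (a , 1F) else (proj₂ (choice a) , 1F)

  decodeSlot : Slot → Fin n × Fin 2
  decodeSlot ((y , _) , s) = decode y s

  choice-end : ∀ {a b c} → choice a ≡ (a , b) → choice b ≡ (a , b) →
               c ≡ a ⊎ c ≡ b → choice c ≡ (a , b)
  choice-end ca _ (inj₁ refl) = ca
  choice-end _ cb (inj₂ refl) = cb

  decode-overflow : ∀ {a b ab} → choice a ≡ (a , b) → choice b ≡ (a , b) →
    ∀ d → decodeSlot (overflow ((a , b) , ab) d) ≡ (b , 1F)
  decode-overflow ca cb (inj₁ w , _ , w∈ab) rewrite choice-end ca cb w∈ab = refl
  decode-overflow ca cb (inj₂ ((c , b′) , _) , _ , ab≢cb′ , c , c∈ab , inj₁ refl)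
    with choice c ≟ᵖ (c , b′) | choice-end ca cb c∈ab
  ... | yes cc | cab = contradiction (trans (sym cab) cc) ab≢cb′
  ... | no _   | cab rewrite cab = refl
  decode-overflow ca cb (inj₂ ((a′ , c) , _) , _ , ab≢a′c , c , c∈ab , inj₂ refl)
    with choice c ≟ᵖ (a′ , c) | choice-end ca cb c∈ab
  ... | yes cc | cab = contradiction (trans (sym cab) cc) ab≢a′c
  ... | no _   | cab rewrite cab = refl

  decode-slot : ∀ v s (c : EdgeOfSAt v) → choice v ≡ proj₁ (EdgeOfSAt.edge c) →
                decodeSlot (slot v s c) ≡ (v , s)
  decode-slot v 0F (edgeOfSAt ((a , b) , _) _ (inj₁ refl)) ca with choice a ≟ᵖ (a , b)
  ... | yes _  = refl
  ... | no ¬ca = contradiction ca ¬ca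
  decode-slot v 0F (edgeOfSAt ((a , b) , _) _ (inj₂ refl)) cb with choice b ≟ᵖ (a , b)
  ... | yes _  = refl
  ... | no ¬cb = contradiction cb ¬cb
  decode-slot v 1F (edgeOfSAt ((a , b) , _) _ (inj₁ refl)) ca with choice a ≟ᵖ (a , b)
  ... | yes _  = refl
  ... | no ¬ca = contradiction ca ¬ca
  decode-slot v 1F (edgeOfSAt ((a , b) , ab) _ (inj₂ refl)) cb with choice a ≟ᵖ (a , b)
  ... | yes ca = decode-overflow ca cb (dominated (inj₂ ((a , b) , ab)))
  ... | no ¬ca with choice a ≟ᵖ (a , b)
  ...   | yes ca = contradiction ca ¬ca
  ...   | no _   = refl

  token : Fin n × Fin 2 → Slot
  token (v , s) = slot v s (edgeOfSAt-every v)

  decode-token : ∀ t → decodeSlot (token t) ≡ t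
  decode-token (v , s) = decode-slot v s (edgeOfSAt-every v) refl

  slotIndex : Slot → Fin (length S * 3)
  slotIndex ((_ , y∈S) , s) = combine (index y∈S) s

  slotIndex-decode : ∀ σ τ → slotIndex σ ≡ slotIndex τ → decodeSlot σ ≡ decodeSlot τ
  slotIndex-decode ((y , y∈S) , s) ((z , z∈S) , t) eq
    with combine-injective (index y∈S) s (index z∈S) t eq
  ... | ind , refl with index-injective (setoid (MVertex G)) y∈S z∈S ind
  ... | refl = refl

  2n≤3∣S∣ : n * 2 ≤ length S * 3
  2n≤3∣S∣ = injective⇒≤ {f = λ x → slotIndex (token (remQuot {n} 2 x))} tokens-distinct
    where
    tokens-distinct : ∀ {x y} → slotIndex (token (remQuot {n} 2 x)) ≡ slotIndex (token (remQuot 2 y)) →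
                      x ≡ y
    tokens-distinct {x} {y} eq = begin
      x                                  ≡⟨ combine-remQuot {n} 2 x ⟨
      uncurry combine (remQuot {n} 2 x)  ≡⟨ cong (uncurry combine) same-token ⟩
      uncurry combine (remQuot {n} 2 y)  ≡⟨ combine-remQuot {n} 2 y ⟩
      y                                  ∎
      where
      open ≡-Reasoning
      same-token : remQuot {n} 2 x ≡ remQuot 2 y
      same-token = trans (sym (decode-token _)) (trans (slotIndex-decode _ _ eq) (decode-token _))

Joins : ∀ {n} (G : Graph n) → Edge G → Fin n → Fin n → Set
Joins G e x y = proj₁ e ≡ (x , y) ⊎ proj₁ e ≡ (y , x)

edgeBetween : ∀ {n} (G : Graph n) x y → adj G x y ≡ true → Edge G
edgeBetween G x y xy with <-cmp x y
... | tri< x<y _ _ = (x , y) , x<y , xy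
... | tri≈ _ refl _ = contradiction (trans (sym xy) (irrefl G x)) λ ()
... | tri> _ _ y<x = (y , x) , y<x , trans (Graph.sym G y x) xy

edgeBetween-joins : ∀ {n} (G : Graph n) x y (xy : adj G x y ≡ true) → Joins G (edgeBetween G x y xy) x y
edgeBetween-joins G x y xy with <-cmp x y
... | tri< _ _ _ = inj₁ refl
... | tri≈ _ refl _ = contradiction (trans (sym xy) (irrefl G x)) λ ()
... | tri> _ _ _ = inj₂ refl

joins-isEndOf : ∀ {n} (G : Graph n) (e : Edge G) {v x y} → Joins G e x y → v ≡ x ⊎ v ≡ y → IsEndOf G v e
joins-isEndOf _ _ (inj₁ refl) v∈xy = v∈xy
joins-isEndOf _ _ (inj₂ refl) v∈xy = Sum.swap v∈xy

joins-unique : ∀ {n} (G : Graph n) (e f : Edge G) {x y x′ y′} → proj₁ e ≡ proj₁ f →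
  Joins G e x y → Joins G f x′ y′ → (x ≡ x′ × y ≡ y′) ⊎ (x ≡ y′ × y ≡ x′)
joins-unique _ _ _ refl (inj₁ refl) (inj₁ refl) = inj₁ (refl , refl)
joins-unique _ _ _ refl (inj₁ refl) (inj₂ refl) = inj₂ (refl , refl)
joins-unique _ _ _ refl (inj₂ refl) (inj₁ refl) = inj₂ (refl , refl)
joins-unique _ _ _ refl (inj₂ refl) (inj₂ refl) = inj₁ (refl , refl)

isEndOf-samePair : ∀ {n} (G : Graph n) {v} (e f : Edge G) → proj₁ e ≡ proj₁ f → IsEndOf G v f → IsEndOf G v e
isEndOf-samePair _ _ _ refl v∈f = v∈f

-- The path with vertices 0, …, k has the edges i = {i, i+1}, i : Fin k.
PathEnd : ∀ {k} → Fin (suc k) → Fin k → Set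
PathEnd j i = j ≡ inject₁ i ⊎ j ≡ suc i

PathAdjacent : ∀ {k} → Fin k → Fin k → Set
PathAdjacent i i′ = suc i ≡ inject₁ i′ ⊎ inject₁ i ≡ suc i′

pathAdjacent-common : ∀ {k} {i i′ : Fin k} → PathAdjacent i i′ → ∃ λ j → PathEnd j i × PathEnd j i′
pathAdjacent-common (inj₁ eq) = _ , inj₂ refl , inj₁ eq
pathAdjacent-common (inj₂ eq) = _ , inj₁ refl , inj₂ eq

pathAdjacent⇒≢ : ∀ {k} {i i′ : Fin k} → PathAdjacent i i′ → i ≢ i′
pathAdjacent⇒≢ {i = i} (inj₁ eq) refl = 1+n≢n (trans (cong toℕ eq) (toℕ-inject₁ i))
pathAdjacent⇒≢ {i = i} (inj₂ eq) refl = 1+n≢n (sym (trans (sym (toℕ-inject₁ i)) (cong toℕ eq)))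

pathEdges-notReversed : ∀ {k} {i j : Fin k} → suc i ≡ inject₁ j → inject₁ i ≢ suc j
pathEdges-notReversed {i = i} {j} i+1≡j i≡j+1 = m+1+n≢n 1 (begin
  suc (suc (toℕ j))    ≡⟨ cong suc (trans (sym (toℕ-inject₁ i)) (cong toℕ i≡j+1)) ⟨
  suc (toℕ i)          ≡⟨ trans (cong toℕ i+1≡j) (toℕ-inject₁ j) ⟩
  toℕ j                ∎)
  where open ≡-Reasoning

pathEnd-shift3 : ∀ {k} {j : Fin (suc k)} {i} → PathEnd j i → PathEnd (3 ↑ʳ j) (3 ↑ʳ i)
pathEnd-shift3 = Sum.map (cong (3 ↑ʳ_)) (cong (3 ↑ʳ_))

pathAdjacent-shift3 : ∀ {k} {i i′ : Fin k} → PathAdjacent i i′ → PathAdjacent (3 ↑ʳ i) (3 ↑ʳ i′)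
pathAdjacent-shift3 = Sum.map (cong (3 ↑ʳ_)) (cong (3 ↑ʳ_))

-- Edges of the path with 3 + k vertices: take two, skip one, and so on;
-- paths with at most five vertices take all their edges.
dominatingEdges : ∀ k → List (Fin (2 + k))
laterDominatingEdges : ∀ k → List (Fin (2 + k))

dominatingEdges k = 0F ∷ 1F ∷ laterDominatingEdges k

laterDominatingEdges 0 = []
laterDominatingEdges 1 = 2F ∷ []
laterDominatingEdges 2 = 2F ∷ 3F ∷ []
laterDominatingEdges (suc (suc (suc k))) = map (3 ↑ʳ_) (dominatingEdges k)

dominatingEdges-cover : ∀ k (j : Fin (3 + k)) → ∃ λ i → i ∈ dominatingEdges k × PathEnd j i
dominatingEdges-cover k 0F = 0F , here refl , inj₁ refl
dominatingEdges-cover k 1F = 0F , here refl , inj₂ refl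
dominatingEdges-cover k 2F = 1F , there (here refl) , inj₂ refl
dominatingEdges-cover 1 3F = 2F , there (there (here refl)) , inj₂ refl
dominatingEdges-cover 2 3F = 2F , there (there (here refl)) , inj₂ refl
dominatingEdges-cover 2 4F = 3F , there (there (there (here refl))) , inj₂ refl
dominatingEdges-cover (suc (suc (suc k))) (suc (suc (suc j))) with dominatingEdges-cover k j
... | i , i∈ , j∈i = 3 ↑ʳ i , there (there (∈-map⁺ (3 ↑ʳ_) i∈)) , pathEnd-shift3 j∈i

dominatingEdges-paired : ∀ k {i} → i ∈ dominatingEdges k →
  ∃ λ i′ → i′ ∈ dominatingEdges k × PathAdjacent i i′
dominatingEdges-paired k (here refl) = 1F , there (here refl) , inj₁ refl
dominatingEdges-paired k (there (here refl)) = 0F , here refl , inj₂ refl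
dominatingEdges-paired 1 (there (there (here refl))) = 1F , there (here refl) , inj₂ refl
dominatingEdges-paired 2 (there (there (here refl))) = 1F , there (here refl) , inj₂ refl
dominatingEdges-paired 2 (there (there (there (here refl)))) = 2F , there (there (here refl)) , inj₂ refl
dominatingEdges-paired (suc (suc (suc k))) (there (there i∈)) with ∈-map⁻ (3 ↑ʳ_) i∈
... | i₀ , i₀∈ , refl with dominatingEdges-paired k i₀∈
... | i′ , i′∈ , adjacent = 3 ↑ʳ i′ , there (there (∈-map⁺ (3 ↑ʳ_) i′∈)) , pathAdjacent-shift3 adjacent

laterDominatingEdges-≥2 : ∀ k {i} → i ∈ laterDominatingEdges k → ∃ λ i′ → i ≡ suc (suc i′)
laterDominatingEdges-≥2 1 (here refl) = _ , refl
laterDominatingEdges-≥2 2 (here refl) = _ , refl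
laterDominatingEdges-≥2 2 (there (here refl)) = _ , refl
laterDominatingEdges-≥2 (suc (suc (suc k))) i∈ with ∈-map⁻ (3 ↑ʳ_) i∈
... | _ , _ , refl = _ , refl

dominatingEdges-unique : ∀ k → Unique (dominatingEdges k)
laterDominatingEdges-unique : ∀ k → Unique (laterDominatingEdges k)

dominatingEdges-unique k =
  ((λ ()) All.∷ All.tabulate (λ i∈ → 0F≢ (laterDominatingEdges-≥2 k i∈))) ∷
  All.tabulate (λ i∈ → 1F≢ (laterDominatingEdges-≥2 k i∈)) ∷
  laterDominatingEdges-unique k
  where
  0F≢ : ∀ {i} → (∃ λ i′ → i ≡ suc (suc i′)) → 0F ≢ i
  0F≢ (_ , refl) ()
  1F≢ : ∀ {i} → (∃ λ i′ → i ≡ suc (suc i′)) → 1F ≢ i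
  1F≢ (_ , refl) ()

laterDominatingEdges-unique 0 = []
laterDominatingEdges-unique 1 = All.[] ∷ []
laterDominatingEdges-unique 2 = ((λ ()) All.∷ All.[]) ∷ All.[] ∷ []
laterDominatingEdges-unique (suc (suc (suc k))) =
  Unique.map⁺ (λ { refl → refl }) (dominatingEdges-unique k)

length-dominatingEdges : ∀ k → length (dominatingEdges k) ≡ ceil2n/3 (3 + k)
length-dominatingEdges 0 = refl
length-dominatingEdges 1 = refl
length-dominatingEdges 2 = refl
length-dominatingEdges (suc (suc (suc k))) = begin
  2 + length (map (3 ↑ʳ_) (dominatingEdges k)) ≡⟨ cong (2 +_) (length-map (3 ↑ʳ_) (dominatingEdges k)) ⟩
  2 + length (dominatingEdges k)               ≡⟨ cong (2 +_) (length-dominatingEdges k) ⟩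
  2 + ceil2n/3 (3 + k)                         ≡⟨ ceil2n/3-+3 (3 + k) ⟨
  ceil2n/3 (3 + (3 + k))                       ∎
  where open ≡-Reasoning

module SpanningPath {k} (G : Graph (suc k)) (π : Permutation′ (suc k))
       (consecutive : ∀ i j → toℕ j ≡ suc (toℕ i) → adj G (π ⟨$⟩ʳ i) (π ⟨$⟩ʳ j) ≡ true) where

  vertex : Fin (suc k) → Fin (suc k)
  vertex i = π ⟨$⟩ʳ i

  vertex-injective : ∀ {i j} → vertex i ≡ vertex j → i ≡ j
  vertex-injective {i} {j} eq = trans (sym (inverseˡ π)) (trans (cong (π ⟨$⟩ˡ_) eq) (inverseˡ π))

  pathEdge : Fin k → Edge G
  pathEdge i = edgeBetween G (vertex (inject₁ i)) (vertex (suc i))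
                 (consecutive (inject₁ i) (suc i) (cong suc (sym (toℕ-inject₁ i))))

  pathEdge-joins : ∀ i → Joins G (pathEdge i) (vertex (inject₁ i)) (vertex (suc i))
  pathEdge-joins i = edgeBetween-joins G _ _ _

  pathEdge-isEndOf : ∀ {j i} → PathEnd j i → IsEndOf G (vertex j) (pathEdge i)
  pathEdge-isEndOf {i = i} j∈i =
    joins-isEndOf G (pathEdge i) (pathEdge-joins i) (Sum.map (cong vertex) (cong vertex) j∈i)

  pathEdge-isEndOf′ : ∀ {v i} → PathEnd (π ⟨$⟩ˡ v) i → IsEndOf G v (pathEdge i)
  pathEdge-isEndOf′ {i = i} v∈i =
    subst (λ w → IsEndOf G w (pathEdge i)) (inverseʳ π) (pathEdge-isEndOf v∈i)

  pathEdge-injective : ∀ {i j} → proj₁ (pathEdge i) ≡ proj₁ (pathEdge j) → i ≡ j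
  pathEdge-injective {i} {j} eq
    with joins-unique G (pathEdge i) (pathEdge j) eq (pathEdge-joins i) (pathEdge-joins j)
  ... | inj₁ (ii , _) = inject₁-injective (vertex-injective ii)
  ... | inj₂ (ij , ji) = contradiction (vertex-injective ij) (pathEdges-notReversed (vertex-injective ji))

  pathEdgesTDS : (L : List (Fin k)) → Unique L →
    (∀ j → ∃ λ i → i ∈ L × PathEnd j i) →
    (∀ {i} → i ∈ L → ∃ λ i′ → i′ ∈ L × PathAdjacent i i′) →
    IsTDS G (map (inj₂ ∘ pathEdge) L)
  pathEdgesTDS L unique cover paired =
    Unique.map⁺ (λ eq → pathEdge-injective (cong proj₁ (inj₂-injective eq))) unique , dominated
    where
    chosen : ∀ {i} → i ∈ L → inj₂ (pathEdge i) ∈ map (inj₂ ∘ pathEdge) L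
    chosen = ∈-map⁺ (inj₂ ∘ pathEdge)

    dominated : ∀ x → ∃ λ y → y ∈ map (inj₂ ∘ pathEdge) L × MAdj G x y
    dominated (inj₁ v) with cover (π ⟨$⟩ˡ v)
    ... | i , i∈L , v∈i = _ , chosen i∈L , pathEdge-isEndOf′ v∈i
    dominated (inj₂ e) with cover (π ⟨$⟩ˡ proj₁ (proj₁ e))
    ... | i , i∈L , u∈i with proj₁ e ≟ᵖ proj₁ (pathEdge i)
    ...   | no e≢i = _ , chosen i∈L , e≢i , _ , inj₁ refl , pathEdge-isEndOf′ u∈i
    -- e is the chosen edge i itself; a chosen neighbour i′ of i meets it in an end of e
    ...   | yes e≡i with paired i∈L
    ...     | i′ , i′∈L , i~i′ with pathAdjacent-common i~i′
    ...       | j , j∈i , j∈i′ =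
      _ , chosen i′∈L ,
      (λ e≡i′ → pathAdjacent⇒≢ i~i′ (pathEdge-injective (trans (sym e≡i) e≡i′))) ,
      _ , isEndOf-samePair G e (pathEdge i) e≡i (pathEdge-isEndOf j∈i) , pathEdge-isEndOf j∈i′

isEndOf-order2 : ∀ (G : Graph 2) (e : Edge G) v → IsEndOf G v e
isEndOf-order2 G ((0F , 1F) , _) 0F = inj₁ refl
isEndOf-order2 G ((0F , 1F) , _) 1F = inj₂ refl
isEndOf-order2 G ((0F , 0F) , () , _) _
isEndOf-order2 G ((1F , 0F) , () , _) _
isEndOf-order2 G ((1F , 1F) , s≤s () , _) _

spanningPath⇒TDS : ∀ {n} (G : Graph n) → 2 ≤ n → HasSpanningPath G →
  ∃ λ S → IsTDS G S × length S ≡ ceil2n/3 n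
spanningPath⇒TDS {0} G () _
spanningPath⇒TDS {1} G (s≤s ()) _
spanningPath⇒TDS {2} G _ (π , consecutive) =
  S , (((λ ()) All.∷ All.[]) ∷ All.[] ∷ [] , dominated) , refl
  where
  open SpanningPath G π consecutive
  S : List (MVertex G)
  S = inj₂ (pathEdge 0F) ∷ inj₁ (vertex 0F) ∷ []
  dominated : ∀ x → ∃ λ y → y ∈ S × MAdj G x y
  dominated (inj₁ v) with π ⟨$⟩ˡ v in eq
  ... | 0F = _ , here refl , pathEdge-isEndOf′ (inj₁ eq)
  ... | 1F = _ , here refl , pathEdge-isEndOf′ (inj₂ eq)
  dominated (inj₂ e) = _ , there (here refl) , isEndOf-order2 G e (vertex 0F)
spanningPath⇒TDS {suc (suc (suc k))} G _ (π , consecutive) =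
  map (inj₂ ∘ pathEdge) (dominatingEdges k) ,
  pathEdgesTDS (dominatingEdges k) (dominatingEdges-unique k)
               (dominatingEdges-cover k) (dominatingEdges-paired k) ,
  trans (length-map (inj₂ ∘ pathEdge) (dominatingEdges k)) (length-dominatingEdges k)
  where open SpanningPath G π consecutive

theorem2p11 : ∀ (n : ℕ) (G : Graph n) → 2 ≤ n → HasSpanningPath G →
    γt-M≡ G (ceil2n/3 n)
theorem2p11 n G 2≤n path =
  spanningPath⇒TDS G 2≤n path ,
  λ S (_ , dominated) → ceil2n/3-least {n} (TokenCounting.2n≤3∣S∣ G S dominated)
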